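{- Let $H=(V,E)$ be a hypergraph with a cut edge $e$. (1) If $e$ is a strong cut edge, then $H$ is not quasi-eulerian. (2) If $H-e$ has at least two non-trivial connected components, then $H$ is not eulerian.
   Context: A hypergraph $H=(V,E)$ has a nonempty finite vertex set $V$ and a finite set $E$ of edges, each associated with a subset of $V$ (parallel edges allowed); hypergraphs are assumed to have no empty edges. A hypersubgraph is $(V',E')$ with $V'\subseteq V$, $E'\subseteq E$; $H-e=(V,E\setminus\{e\})$. A walk is a sequence $v_0e_1v_1\dots e_kv_k$ with $v_{i-1}\ne v_i$ and $v_{i-1},v_i\in e_i$; $H$ is connected if any two distinct vertices are joined by a walk. The connected components of $H$ are its maximal connected hypersubgraphs without empty edges; $\mathrm{cc}(H)$ denotes their number; a component is trivial if it has a single vertex. An edge $e$ is a cut edge if $\mathrm{cc}(H-e)>\mathrm{cc}(H)$; it is strong if $\mathrm{cc}(H-e)=\mathrm{cc}(H)+|e|-1$. A walk is closed if $k\ge 2$ and $v_0=v_k$, and a strict trail if its edges are pairwise distinct; its anchors are $v_0,\dots,v_k$. An Euler tour is a closed strict trail traversing every edge; $H$ is eulerian if it has one. An Euler family is a family of pairwise anchor-disjoint closed strict trails such that each edge lies in exactly one of them; $H$ is quasi-eulerian if it has one. -}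

module Defs where

open import Data.Nat using (ℕ; zero; suc; _+_; _∸_; _<_; _≤_)
open import Data.Fin using (Fin; zero; suc; inject₁; fromℕ; punchIn)
open import Data.Fin.Subset using (Subset; _∈_; Nonempty; ∣_∣)
open import Data.Product using (Σ; ∃; ∃-syntax; _×_; _,_)
open import Data.Sum using (_⊎_)
open import Relation.Binary.PropositionalEquality using (_≡_; _≢_)
open import Relation.Nullary using (¬_)
open import Function.Bundles using (_⇔_)

-- A hypergraph with vertex set Fin n and edge set Fin m (edges are labels,
-- so parallel edges are allowed); each edge is associated with a subset of
-- the vertices, and edges are nonempty.
record Hypergraph (n m : ℕ) : Set where
  field
    inc      : Fin m → Subset n
    nonEmpty : ∀ e → Nonempty (inc e)
open Hypergraph public

deleteEdge : ∀ {n m} → Hypergraph n (suc m) → Fin (suc m) → Hypergraph n m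
deleteEdge H e = record
  { inc      = λ f → inc H (punchIn e f)
  ; nonEmpty = λ f → nonEmpty H (punchIn e f) }

edgeSize : ∀ {n m} → Hypergraph n m → Fin m → ℕ
edgeSize H e = ∣ inc H e ∣

-- A walk v₀ e₁ v₁ … e_k v_k : vertices vs 0 … vs k, edges es 0 … es (k-1)
-- (es i is the edge e_{i+1} between vs i and vs (i+1)).
record Walk {n m : ℕ} (H : Hypergraph n m) : Set where
  field
    len   : ℕ
    verts : Fin (suc len) → Fin n
    edges : Fin len → Fin m
    step≢ : ∀ i → verts (inject₁ i) ≢ verts (suc i)
    stepˡ : ∀ i → verts (inject₁ i) ∈ inc H (edges i)
    stepʳ : ∀ i → verts (suc i) ∈ inc H (edges i)
open Walk public

start end : ∀ {n m} {H : Hypergraph n m} → Walk H → Fin n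
start W = verts W zero
end   W = verts W (fromℕ (len W))

Joined : ∀ {n m} → Hypergraph n m → Fin n → Fin n → Set
Joined H u v = u ≡ v ⊎ Σ (Walk H) (λ W → start W ≡ u × end W ≡ v)

-- Connected components, described by labelling each vertex with the index
-- (in Fin k) of the component containing it: two vertices get the same label
-- iff they are joined by a walk, and every label is used.  Thus
-- HasComponents H k c  says that c is such a labelling and cc(H) = k.
record HasComponents {n m : ℕ} (H : Hypergraph n m) (k : ℕ) (c : Fin n → Fin k) : Set where
  field
    surjective : ∀ (a : Fin k) → ∃[ v ] c v ≡ a
    sameComp   : ∀ u v → (c u ≡ c v) ⇔ Joined H u v

CC : ∀ {n m} → Hypergraph n m → ℕ → Set
CC H k = ∃[ c ] HasComponents H k c

CutEdge : ∀ {n m} → (H : Hypergraph n (suc m)) → Fin (suc m) → Set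
CutEdge H e = ∃[ k ] ∃[ k' ] (CC H k × CC (deleteEdge H e) k' × k < k')

StrongCutEdge : ∀ {n m} → (H : Hypergraph n (suc m)) → Fin (suc m) → Set
StrongCutEdge H e = ∃[ k ] ∃[ k' ]
  (CC H k × CC (deleteEdge H e) k' × k' ≡ k + edgeSize H e ∸ 1)

NontrivialComp : ∀ {n k} → (Fin n → Fin k) → Fin k → Set
NontrivialComp c a = ∃[ u ] ∃[ v ] (u ≢ v × c u ≡ a × c v ≡ a)

AtLeastTwoNontrivial : ∀ {n m} → Hypergraph n m → Set
AtLeastTwoNontrivial H = ∃[ k ] Σ (Fin _ → Fin k) (λ c →
  HasComponents H k c × ∃[ a ] ∃[ b ] (a ≢ b × NontrivialComp c a × NontrivialComp c b))

Closed : ∀ {n m} {H : Hypergraph n m} → Walk H → Set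
Closed W = 2 ≤ len W × start W ≡ end W

Strict : ∀ {n m} {H : Hypergraph n m} → Walk H → Set
Strict W = ∀ i j → edges W i ≡ edges W j → i ≡ j

Traverses : ∀ {n m} {H : Hypergraph n m} → Walk H → Fin m → Set
Traverses W f = ∃[ i ] edges W i ≡ f

EulerTour : ∀ {n m} {H : Hypergraph n m} → Walk H → Set
EulerTour W = Closed W × Strict W × (∀ f → Traverses W f)

Eulerian : ∀ {n m} → Hypergraph n m → Set
Eulerian H = ∃[ W ] EulerTour {H = H} W

record EulerFamily {n m : ℕ} (H : Hypergraph n m) : Set where
  field
    size     : ℕ
    trail    : Fin size → Walk H
    closed   : ∀ a → Closed (trail a)
    strict   : ∀ a → Strict (trail a)
    disjoint : ∀ a b → a ≢ b → ∀ i j → verts (trail a) i ≢ verts (trail b) j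
    covers   : ∀ f → ∃[ a ] Traverses (trail a) f
    unique   : ∀ f a b → Traverses (trail a) f → Traverses (trail b) f → a ≡ b

QuasiEulerian : ∀ {n m} → Hypergraph n m → Set
QuasiEulerian H = EulerFamily H

module Submission where

-- If a closed strict trail T of H traverses e, entering e at x₁ and leaving it at x₂, then the rest
-- of T, read from x₂ onwards, is a walk back to x₁ that avoids e.  (1) Thus two distinct vertices of e
-- lie in the same component of H − e.  Each component of H − e either lies in a component of H other
-- than that of e, or contains a vertex of e; so H − e has at most cc(H) + |e| − 2 components and e is
-- not strong.  (2) If T is an Euler tour, every edge other than e lies on that walk, so every
-- non-trivial component of H − e contains x₁.

open import Defs
open import Data.Nat using (ℕ; zero; suc; _+_; _∸_; _≤_; s≤s)
open import Data.Nat.Properties using (1+n≰n)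
open import Data.Fin using (Fin; zero; suc; inject₁; fromℕ; punchIn; punchOut; join; splitAt; _≟_)
open import Data.Fin.Properties using (punchIn-punchOut; punchInᵢ≢i; splitAt-join; injective⇒≤)
open import Data.Fin.Subset using (Subset; inside; outside; ∣_∣) renaming (_∈_ to _∈ₛ_)
open import Data.Vec using ([]; _∷_)
open import Data.Vec.Base using (here; there)
open import Data.List using (List; []; _∷_; _++_; map; length; lookup; tabulate)
open import Data.List.Properties using (length-map)
open import Data.List.Membership.Propositional using (_∈_; _∉_)
open import Data.List.Membership.Propositional.Properties using (∈-++⁺ˡ; ∈-++⁺ʳ; ∈-++⁻; ∈-tabulate⁺; ∈-map⁺)
open import Data.List.Relation.Unary.All using (All; []; _∷_)
import Data.List.Relation.Unary.All as All
open import Data.List.Relation.Unary.Any using (here; there; index)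
open import Data.List.Relation.Unary.Any.Properties using (lookup-index; ++-comm)
open import Data.List.Relation.Unary.AllPairs using (_∷_)
open import Data.List.Relation.Unary.Unique.Propositional using (Unique)
import Data.List.Relation.Unary.Unique.Propositional.Properties as Unique
open import Data.Product using (_×_; _,_; Σ; ∃; ∃-syntax; proj₁; proj₂)
open import Data.Sum using (_⊎_; inj₁; inj₂)
open import Relation.Nullary using (¬_; yes; no; contradiction)
open import Relation.Binary.PropositionalEquality using (_≡_; _≢_; refl; sym; trans; cong; subst; subst₂)
open import Function.Bundles using (Equivalence)

injective-avoiding-two⇒≤ : ∀ {a b} (f : Fin a → Fin b) → (∀ {i j} → f i ≡ f j → i ≡ j) →
  ∀ {y₁ y₂} → y₁ ≢ y₂ → (∀ i → f i ≢ y₁) → (∀ i → f i ≢ y₂) → 2 + a ≤ b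
injective-avoiding-two⇒≤ {a} {b} f f-inj {y₁} {y₂} y₁≢y₂ f≢y₁ f≢y₂ = injective⇒≤ g-inj
  where
    g : Fin (2 + a) → Fin b
    g zero          = y₁
    g (suc zero)    = y₂
    g (suc (suc i)) = f i
    g-inj : ∀ {i j} → g i ≡ g j → i ≡ j
    g-inj {zero}        {zero}        _  = refl
    g-inj {zero}        {suc zero}    eq = contradiction eq y₁≢y₂
    g-inj {zero}        {suc (suc j)} eq = contradiction (sym eq) (f≢y₁ j)
    g-inj {suc zero}    {zero}        eq = contradiction (sym eq) y₁≢y₂
    g-inj {suc zero}    {suc zero}    _  = refl
    g-inj {suc zero}    {suc (suc j)} eq = contradiction (sym eq) (f≢y₂ j)
    g-inj {suc (suc i)} {zero}        eq = contradiction eq (f≢y₁ i)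
    g-inj {suc (suc i)} {suc zero}    eq = contradiction eq (f≢y₂ i)
    g-inj {suc (suc i)} {suc (suc j)} eq = cong (λ x → suc (suc x)) (f-inj eq)

join-injective : ∀ k l {s t : Fin k ⊎ Fin l} → join k l s ≡ join k l t → s ≡ t
join-injective k l {s} {t} eq =
  trans (sym (splitAt-join k l s)) (trans (cong (splitAt k) eq) (splitAt-join k l t))

elements : ∀ {n} → Subset n → List (Fin n)
elements []            = []
elements (inside ∷ p)  = zero ∷ map suc (elements p)
elements (outside ∷ p) = map suc (elements p)

∈ₛ⇒∈-elements : ∀ {n} {x : Fin n} {p} → x ∈ₛ p → x ∈ elements p
∈ₛ⇒∈-elements here = here refl
∈ₛ⇒∈-elements {p = inside ∷ _}  (there x∈p) = there (∈-map⁺ suc (∈ₛ⇒∈-elements x∈p))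
∈ₛ⇒∈-elements {p = outside ∷ _} (there x∈p) = ∈-map⁺ suc (∈ₛ⇒∈-elements x∈p)

length-elements : ∀ {n} (p : Subset n) → length (elements p) ≡ ∣ p ∣
length-elements []            = refl
length-elements (inside ∷ p)  = cong suc (trans (length-map suc (elements p)) (length-elements p))
length-elements (outside ∷ p) = trans (length-map suc (elements p)) (length-elements p)

∉-middle : ∀ {a} {A : Set a} (xs : List A) {f ys} → Unique (xs ++ f ∷ ys) → f ∉ xs ++ ys
∉-middle []       (f∉ys ∷ _)    f∈ys             = All.lookup f∉ys f∈ys refl
∉-middle (x ∷ xs) (x∉rest ∷ _)  (here refl)      = All.lookup x∉rest (∈-++⁺ʳ xs (here refl)) refl
∉-middle (x ∷ xs) (_ ∷ unique)  (there f∈xs++ys) = ∉-middle xs unique f∈xs++ys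

∈-rotate : ∀ {a} {A : Set a} (xs : List A) {f g ys} → g ∈ xs ++ f ∷ ys → g ≢ f → g ∈ ys ++ xs
∈-rotate xs {ys = ys} g∈ g≢f with ∈-++⁻ xs g∈
... | inj₁ g∈xs          = ∈-++⁺ʳ ys g∈xs
... | inj₂ (here g≡f)    = contradiction g≡f g≢f
... | inj₂ (there g∈ys)  = ∈-++⁺ˡ g∈ys

data Path {n m} (G : Hypergraph n m) : Fin n → Fin n → Set where
  []   : ∀ {u} → Path G u u
  step : ∀ {u v w} f → u ≢ v → u ∈ₛ inc G f → v ∈ₛ inc G f → Path G v w → Path G u w

module _ {n m} {G : Hypergraph n m} where

  edgesOf : ∀ {u v} → Path G u v → List (Fin m)
  edgesOf []               = []
  edgesOf (step f _ _ _ p) = f ∷ edgesOf p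

  _++ᵖ_ : ∀ {u v w} → Path G u v → Path G v w → Path G u w
  []             ++ᵖ q = q
  step f d a b p ++ᵖ q = step f d a b (p ++ᵖ q)

  edgesOf-++ᵖ : ∀ {u v w} (p : Path G u v) (q : Path G v w) →
                edgesOf (p ++ᵖ q) ≡ edgesOf p ++ edgesOf q
  edgesOf-++ᵖ []               q = refl
  edgesOf-++ᵖ (step f _ _ _ p) q = cong (f ∷_) (edgesOf-++ᵖ p q)

  edgePath : ∀ {u v} f → u ∈ₛ inc G f → v ∈ₛ inc G f → Path G u v
  edgePath {u} {v} f u∈f v∈f with u ≟ v
  ... | yes refl = []
  ... | no u≢v  = step f u≢v u∈f v∈f []

  path⇒walk : ∀ {u w} → Path G u w → Σ (Walk G) (λ W → start W ≡ u × end W ≡ w)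
  path⇒walk {u} [] = record
    { len = 0 ; verts = λ _ → u ; edges = λ () ; step≢ = λ () ; stepˡ = λ () ; stepʳ = λ () }
    , refl , refl
  path⇒walk {u} (step f u≢v u∈f v∈f p) with path⇒walk p
  ... | W , refl , end≡w = record
    { len = suc (len W) ; verts = vs ; edges = es ; step≢ = vs≢ ; stepˡ = vs∈ˡ ; stepʳ = vs∈ʳ }
    , refl , end≡w
    where
      vs : Fin (suc (suc (len W))) → Fin n
      vs zero    = u
      vs (suc i) = verts W i
      es : Fin (suc (len W)) → Fin m
      es zero    = f
      es (suc i) = edges W i
      vs≢ : ∀ i → vs (inject₁ i) ≢ vs (suc i)
      vs≢ zero    = u≢v
      vs≢ (suc i) = step≢ W i
      vs∈ˡ : ∀ i → vs (inject₁ i) ∈ₛ inc G (es i)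
      vs∈ˡ zero    = u∈f
      vs∈ˡ (suc i) = stepˡ W i
      vs∈ʳ : ∀ i → vs (suc i) ∈ₛ inc G (es i)
      vs∈ʳ zero    = v∈f
      vs∈ʳ (suc i) = stepʳ W i

  -- The fields of a walk of length l, unbundled so that recursion on l is structural.
  fieldsPath : ∀ l (vs : Fin (suc l) → Fin n) (es : Fin l → Fin m) →
    (∀ i → vs (inject₁ i) ≢ vs (suc i)) → (∀ i → vs (inject₁ i) ∈ₛ inc G (es i)) →
    (∀ i → vs (suc i) ∈ₛ inc G (es i)) →
    Σ (Path G (vs zero) (vs (fromℕ l))) (λ p → edgesOf p ≡ tabulate es)
  fieldsPath zero    vs es _ _ _ = [] , refl
  fieldsPath (suc l) vs es vs≢ vs∈ˡ vs∈ʳ with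
    fieldsPath l (λ i → vs (suc i)) (λ i → es (suc i))
               (λ i → vs≢ (suc i)) (λ i → vs∈ˡ (suc i)) (λ i → vs∈ʳ (suc i))
  ... | p , edges≡ = step (es zero) (vs≢ zero) (vs∈ˡ zero) (vs∈ʳ zero) p , cong (es zero ∷_) edges≡

  walk⇒path : (W : Walk G) → Σ (Path G (start W) (end W)) (λ p → edgesOf p ≡ tabulate (edges W))
  walk⇒path W = fieldsPath (len W) (verts W) (edges W) (step≢ W) (stepˡ W) (stepʳ W)

  module _ {k c} (hc : HasComponents G k c) where

    path⇒sameComponent : ∀ {u v} → Path G u v → c u ≡ c v
    path⇒sameComponent {u} {v} p =
      Equivalence.from (HasComponents.sameComp hc u v) (inj₂ (path⇒walk p))

    sameComponent⇒path : ∀ {u v} → c u ≡ c v → Path G u v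
    sameComponent⇒path {u} {v} cu≡cv with Equivalence.to (HasComponents.sameComp hc u v) cu≡cv
    ... | inj₁ refl              = []
    ... | inj₂ (W , refl , refl) = proj₁ (walk⇒path W)

    nontrivial⇒edgeVertex : ∀ {a} → NontrivialComp c a → ∃[ f ] ∃[ u ] (u ∈ₛ inc G f × c u ≡ a)
    nontrivial⇒edgeVertex (u , v , u≢v , cu≡a , cv≡a) with sameComponent⇒path (trans cu≡a (sym cv≡a))
    ... | []               = contradiction refl u≢v
    ... | step f _ u∈f _ _ = f , u , u∈f , cu≡a

record Split {n m} {G : Hypergraph n m} {u w} (p : Path G u w) (f : Fin m) : Set where
  field
    {x₁ x₂}       : Fin n
    x₁≢x₂         : x₁ ≢ x₂
    x₁∈f          : x₁ ∈ₛ inc G f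
    x₂∈f          : x₂ ∈ₛ inc G f
    before        : Path G u x₁
    after         : Path G x₂ w
    edgesOf-split : edgesOf p ≡ edgesOf before ++ f ∷ edgesOf after

split : ∀ {n m} {G : Hypergraph n m} {u w f} (p : Path G u w) → f ∈ edgesOf p → Split p f
split (step f d a b p) (here refl) = record
  { x₁≢x₂ = d ; x₁∈f = a ; x₂∈f = b ; before = [] ; after = p ; edgesOf-split = refl }
split (step g d a b p) (there f∈p) = record
  { Split s ; before = step g d a b before ; edgesOf-split = cong (g ∷_) edgesOf-split }
  where
    s = split p f∈p
    open Split s

module _ {n m} {H : Hypergraph n (suc m)} {e : Fin (suc m)} where

  private
    H∖e = deleteEdge H e

  stepᵉ : ∀ {u v w} f → f ≢ e → u ≢ v → u ∈ₛ inc H f → v ∈ₛ inc H f → Path H∖e v w → Path H∖e u w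
  stepᵉ f f≢e u≢v u∈f v∈f = step (punchOut e≢f) u≢v (inc-punchOut u∈f) (inc-punchOut v∈f)
    where
      e≢f = λ e≡f → f≢e (sym e≡f)
      inc-punchOut : ∀ {x} → x ∈ₛ inc H f → x ∈ₛ inc H (punchIn e (punchOut e≢f))
      inc-punchOut = subst (λ g → _ ∈ₛ inc H g) (sym (punchIn-punchOut e≢f))

  avoiding⇒path : ∀ {u v} (p : Path H u v) → All (_≢ e) (edgesOf p) → Path H∖e u v
  avoiding⇒path []                       []             = []
  avoiding⇒path (step f u≢v u∈f v∈f p) (f≢e ∷ avoids) = stepᵉ f f≢e u≢v u∈f v∈f (avoiding⇒path p avoids)

  avoiding-reaches : ∀ {u w g} (p : Path H u w) → All (_≢ e) (edgesOf p) → g ∈ edgesOf p →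
                     ∃[ y ] (y ∈ₛ inc H g × Path H∖e y w)
  avoiding-reaches {u} p@(step _ _ u∈g _ _) avoids (here refl) = u , u∈g , avoiding⇒path p avoids
  avoiding-reaches (step _ _ _ _ p) (_ ∷ avoids) (there g∈p) = avoiding-reaches p avoids g∈p

  record Bypass (Covered : Fin (suc m) → Set) : Set where
    field
      {x₁ x₂} : Fin n
      x₁≢x₂   : x₁ ≢ x₂
      x₁∈e    : x₁ ∈ₛ inc H e
      x₂∈e    : x₂ ∈ₛ inc H e
      link    : Path H∖e x₂ x₁
      reach   : ∀ {g} → Covered g → g ≢ e → ∃[ y ] (y ∈ₛ inc H g × Path H∖e y x₁)

  Bypass-mono : ∀ {C D : Fin (suc m) → Set} → (∀ {g} → C g → D g) → Bypass D → Bypass C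
  Bypass-mono C⊆D b = record { Bypass b ; reach = λ g∈C → reach (C⊆D g∈C) } where open Bypass b

  -- Rotating a closed path to start just after its unique occurrence of e leaves an e-free path.
  closedPath-bypass : ∀ {u w} (p : Path H u w) → u ≡ w → Unique (edgesOf p) → e ∈ edgesOf p →
                      Bypass (_∈ edgesOf p)
  closedPath-bypass p refl unique e∈p = record
    { x₁≢x₂ = x₁≢x₂ ; x₁∈e = x₁∈f ; x₂∈e = x₂∈f
    ; link  = avoiding⇒path rotated avoids
    ; reach = λ g∈p g≢e → avoiding-reaches rotated avoids (∈-rotated g∈p g≢e) }
    where
      open Split (split p e∈p)
      rotated = after ++ᵖ before
      xs = edgesOf before
      ys = edgesOf after
      e∉xs++ys : e ∉ xs ++ ys
      e∉xs++ys = ∉-middle xs (subst Unique edgesOf-split unique)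
      avoids : All (_≢ e) (edgesOf rotated)
      avoids = All.tabulate λ g∈ g≡e → e∉xs++ys (++-comm ys xs
        (subst₂ _∈_ g≡e (edgesOf-++ᵖ after before) g∈))
      ∈-rotated : ∀ {g} → g ∈ edgesOf p → g ≢ e → g ∈ edgesOf rotated
      ∈-rotated g∈p g≢e = subst (_ ∈_) (sym (edgesOf-++ᵖ after before))
        (∈-rotate xs (subst (_ ∈_) edgesOf-split g∈p) g≢e)

  closedTrail-bypass : (W : Walk H) → Closed W → Strict W → Traverses W e → Bypass (Traverses W)
  closedTrail-bypass W (_ , closed) strict (i , eᵢ≡e) with walk⇒path W
  ... | p , edges≡ = Bypass-mono traversed⇒∈
      (closedPath-bypass p closed (subst Unique (sym edges≡) (Unique.tabulate⁺ (strict _ _)))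
                                  (traversed⇒∈ (i , eᵢ≡e)))
    where
      traversed⇒∈ : ∀ {g} → Traverses W g → g ∈ edgesOf p
      traversed⇒∈ (j , refl) = subst (_ ∈_) (sym edges≡) (∈-tabulate⁺ j)

  -- The first vertex of e on a path is reached without using e.
  reachEdge : ∀ {w y} → Path H w y → y ∈ₛ inc H e → ∃[ x ] (x ∈ₛ inc H e × Path H∖e w x)
  reachEdge {w} []                     y∈e = w , y∈e , []
  reachEdge {w} (step f u≢v u∈f v∈f p) y∈e with f ≟ e
  ... | yes refl = w , u∈f , []
  ... | no f≢e with reachEdge p y∈e
  ... | x , x∈e , p′ = x , x∈e , stepᵉ f f≢e u≢v u∈f v∈f p′

  module _ {k c} (hc : HasComponents H k c) {x₀} (x₀∈e : x₀ ∈ₛ inc H e) where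

    avoidComponent : ∀ {u v} → Path H u v → c u ≢ c x₀ → Path H∖e u v
    avoidComponent []                     _ = []
    avoidComponent (step f u≢v u∈f v∈f p) cu≢cx₀ with f ≟ e
    ... | yes refl = contradiction (path⇒sameComponent hc (edgePath e u∈f x₀∈e)) cu≢cx₀
    ... | no f≢e   = stepᵉ f f≢e u≢v u∈f v∈f (avoidComponent p λ cv≡cx₀ →
                       cu≢cx₀ (trans (path⇒sameComponent hc (edgePath f u∈f v∈f)) cv≡cx₀))

  module _ {k c} (hc : HasComponents H k c) {k′ c′} (hc′ : HasComponents H∖e k′ c′)
           {x₁ x₂} (x₁≢x₂ : x₁ ≢ x₂) (x₁∈e : x₁ ∈ₛ inc H e) (x₂∈e : x₂ ∈ₛ inc H e)
           (x₂⇝x₁ : Path H∖e x₂ x₁) where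

    private
      vertices = elements (inc H e)
      L = length vertices
      index-x₂ = index (∈ₛ⇒∈-elements x₂∈e)

    -- Components of H − e inside the component of e get a vertex of e as label, never x₂:
    -- it shares its component with x₁.
    Label : Fin k′ → Fin k ⊎ Fin L → Set
    Label a (inj₁ b) = b ≢ c x₁ × ∃[ w ] (c′ w ≡ a × c w ≡ b)
    Label a (inj₂ j) = lookup vertices j ≢ x₂ × c′ (lookup vertices j) ≡ a

    vertexLabel : ∀ {a x} → x ∈ₛ inc H e → x ≢ x₂ → c′ x ≡ a → ∃ (Label a)
    vertexLabel x∈e x≢x₂ cx≡a = inj₂ (index x∈)
      , (λ eq → x≢x₂ (trans (lookup-index x∈) eq)) , trans (cong c′ (sym (lookup-index x∈))) cx≡a
      where x∈ = ∈ₛ⇒∈-elements x∈e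

    label : ∀ a → ∃ (Label a)
    label a with HasComponents.surjective hc′ a
    ... | w , c′w≡a with c w ≟ c x₁
    ... | no cw≢cx₁ = inj₁ (c w) , cw≢cx₁ , w , c′w≡a , refl
    ... | yes cw≡cx₁ with reachEdge (sameComponent⇒path hc cw≡cx₁) x₁∈e
    ... | x , x∈e , w⇝x with x ≟ x₂
    ... | no x≢x₂  = vertexLabel x∈e x≢x₂ (trans (sym (path⇒sameComponent hc′ w⇝x)) c′w≡a)
    ... | yes refl = vertexLabel x₁∈e x₁≢x₂
          (trans (sym (path⇒sameComponent hc′ (w⇝x ++ᵖ x₂⇝x₁))) c′w≡a)

    Label-injective : ∀ {a b} t → Label a t → Label b t → a ≡ b
    Label-injective (inj₁ _) (cw≢cx₁ , w , c′w≡a , cw≡t) (_ , v , c′v≡b , cv≡t) =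
      trans (sym c′w≡a) (trans (path⇒sameComponent hc′ w⇝v) c′v≡b)
      where
        w⇝v = avoidComponent hc x₁∈e (sameComponent⇒path hc (trans cw≡t (sym cv≡t)))
                (λ eq → cw≢cx₁ (trans (sym cw≡t) eq))
    Label-injective (inj₂ _) (_ , c′x≡a) (_ , c′x≡b) = trans (sym c′x≡a) c′x≡b

    Label≢x₁ : ∀ {a} t → Label a t → t ≢ inj₁ (c x₁)
    Label≢x₁ (inj₁ _) (b≢cx₁ , _) refl = b≢cx₁ refl

    Label≢x₂ : ∀ {a} t → Label a t → t ≢ inj₂ index-x₂
    Label≢x₂ (inj₂ _) (x≢x₂ , _) refl = x≢x₂ (sym (lookup-index (∈ₛ⇒∈-elements x₂∈e)))

    components-bound : 2 + k′ ≤ k + ∣ inc H e ∣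
    components-bound = subst (λ l → 2 + k′ ≤ k + l) (length-elements (inc H e))
      (injective-avoiding-two⇒≤ φ φ-inj y₁≢y₂
        (λ a eq → Label≢x₁ _ (proj₂ (label a)) (join-injective k L eq))
        (λ a eq → Label≢x₂ _ (proj₂ (label a)) (join-injective k L eq)))
      where
        y₁≢y₂ : join k L (inj₁ (c x₁)) ≢ join k L (inj₂ index-x₂)
        y₁≢y₂ eq with join-injective k L {inj₁ (c x₁)} {inj₂ index-x₂} eq
        ... | ()
        φ : Fin k′ → Fin (k + L)
        φ a = join k L (proj₁ (label a))
        φ-inj : ∀ {a b} → φ a ≡ φ b → a ≡ b
        φ-inj {a} {b} eq = Label-injective _ (proj₂ (label a))
          (subst (Label b) (sym (join-injective k L eq)) (proj₂ (label b)))

2+[n∸1]≰n : ∀ n → ¬ (2 + (n ∸ 1) ≤ n)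
2+[n∸1]≰n (suc n) (s≤s le) = 1+n≰n le

strongCutEdge⇒¬quasiEulerian : ∀ {n m} {H : Hypergraph n (suc m)} {e} →
  StrongCutEdge H e → ¬ QuasiEulerian H
strongCutEdge⇒¬quasiEulerian {H = H} {e} (k , k′ , (c , hc) , (c′ , hc′) , k′≡) family
  with EulerFamily.covers family e
... | t , e∈t = 2+[n∸1]≰n (k + edgeSize H e)
  (subst (λ k′ → 2 + k′ ≤ k + edgeSize H e) k′≡ (components-bound hc hc′ x₁≢x₂ x₁∈e x₂∈e link))
  where
    open EulerFamily family
    open Bypass (closedTrail-bypass (trail t) (closed t) (strict t) e∈t)

twoNontrivial⇒¬eulerian : ∀ {n m} {H : Hypergraph n (suc m)} {e} →
  AtLeastTwoNontrivial (deleteEdge H e) → ¬ Eulerian H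
twoNontrivial⇒¬eulerian {e = e} (k , c , hc , a , b , a≢b , a-nontrivial , b-nontrivial)
                                (W , closed , strict , traverses) =
  a≢b (trans (sym (containsBypass a-nontrivial)) (containsBypass b-nontrivial))
  where
    open Bypass (closedTrail-bypass W closed strict (traverses e))
    containsBypass : ∀ {a} → NontrivialComp c a → c x₁ ≡ a
    containsBypass nontrivial with nontrivial⇒edgeVertex hc nontrivial
    ... | f , u , u∈f , cu≡a with reach (traverses (punchIn e f)) (punchInᵢ≢i e f)
    ... | y , y∈f , y⇝x₁ = trans (sym (path⇒sameComponent hc (edgePath f u∈f y∈f ++ᵖ y⇝x₁))) cu≡a

mainTheorem3 : ∀ (n m : ℕ) (H : Hypergraph (suc n) (suc m)) (e : Fin (suc m)) →
    CutEdge H e →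
    (StrongCutEdge H e → ¬ QuasiEulerian H) ×
    (AtLeastTwoNontrivial (deleteEdge H e) → ¬ Eulerian H)
mainTheorem3 n m H e _ = strongCutEdge⇒¬quasiEulerian , twoNontrivial⇒¬eulerian
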